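{- Let $n\in\mathbb{N}$, let $E_0,\dots,E_{n-1}$ be pairwise disjoint sets with $E=\bigcup_{i<n}E_i$, let $U_i$ be a uniform matroid on $E_i$ for each $i<n$, let $N=\bigoplus_{i<n}U_i$, and let $M$ be any matroid on $E$. Then every set $I$ that is independent in both $M$ and $N$ is contained in a $\subseteq$-maximal element of $\mathcal{I}_M\cap\mathcal{I}_N$.
   Context: Matroids are possibly infinite (B-)matroids: a matroid on $E$ is a pair $(E,\mathcal{I})$ with $\mathcal{I}\subseteq\mathcal{P}(E)$ such that (i) $\varnothing\in\mathcal{I}$; (ii) $\mathcal{I}$ is closed under subsets; (iii) for all $I,J\in\mathcal{I}$ with $J$ $\subseteq$-maximal in $\mathcal{I}$ and $I$ not maximal, there is $e\in J\setminus I$ with $I\cup\{e\}\in\mathcal{I}$; (iv) for every $X\subseteq E$, every $I\in\mathcal{I}$ with $I\subseteq X$ extends to a $\subseteq$-maximal element of $\{J\in\mathcal{I}:J\subseteq X\}$. $\mathcal{I}_M$ denotes the set of independent sets of $M$. A matroid $(E,\mathcal{I})$ is uniform if for every $I\in\mathcal{I}$, $e\in I$ and $f\in E\setminus I$ we have $(I\setminus\{e\})\cup\{f\}\in\mathcal{I}$. The direct sum $\bigoplus_i U_i$ is the matroid on $\bigcup_i E_i$ in which $I$ is independent iff $I\cap E_i$ is independent in $U_i$ for all $i$. -}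

module Defs where

open import Level using (0ℓ)
open import Data.Nat using (ℕ)
open import Data.Fin using (Fin)
open import Data.Product using (Σ; ∃; _×_; _,_)
open import Data.Sum using (_⊎_)
open import Data.Empty using (⊥)
open import Relation.Nullary using (¬_)
open import Relation.Binary.PropositionalEquality using (_≡_; _≢_)
open import Relation.Unary using (Pred; _⊆_; _∩_)

Subset : Set → Set₁
Subset E = Pred E 0ℓ

Family : Set → Set₁
Family E = Subset E → Set

_∪｛_｝ : {E : Set} → Subset E → E → Subset E
(I ∪｛ e ｝) x = I x ⊎ x ≡ e

swap : {E : Set} → Subset E → E → E → Subset E
swap I e f x = (I x × x ≢ e) ⊎ x ≡ f

Maximal : {E : Set} → Family E → Subset E → Set₁
Maximal F J = F J × (∀ K → F K → J ⊆ K → K ⊆ J)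

-- (E',𝓘) is a (possibly infinite) matroid, where the ground set E' is a
-- subset G of an ambient type E and 𝓘 a family of subsets of G.
record IsMatroid {E : Set} (G : Subset E) (Ind : Family E) : Set₁ where
  field
    ground    : ∀ I → Ind I → I ⊆ G
    empty     : Ind (λ _ → ⊥)
    down      : ∀ I J → Ind J → I ⊆ J → Ind I
    augment   : ∀ I J → Ind I → Maximal Ind J → ¬ Maximal Ind I →
                Σ E (λ e → J e × ¬ I e × Ind (I ∪｛ e ｝))
    maximal   : ∀ (X : Subset E) → X ⊆ G → ∀ I → Ind I → I ⊆ X →
                Σ (Subset E) (λ J → Maximal (λ K → Ind K × K ⊆ X) J × I ⊆ J)

IsUniform : {E : Set} (G : Subset E) (Ind : Family E) → Set₁
IsUniform {E} G Ind = ∀ I (e f : E) → Ind I → I e → G f → ¬ I f → Ind (swap I e f)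

DirectSumInd : {E : Set} (n : ℕ) (Es : Fin n → Subset E) (Us : Fin n → Family E) → Family E
DirectSumInd n Es Us I = ∀ i → Us i (I ∩ Es i)

-- Keep the blocks i whose part I ∩ Eᵢ is not yet a base of Uᵢ in a list L.
-- Extend I to a set J that is maximal M-independent inside I together with
-- all blocks in L.  If J is also N-independent it is maximal in 𝓘_M ∩ 𝓘_N:
-- an element of an open block would have been added to J, and the other
-- blocks already carry a base of Uᵢ.  Otherwise some block i ∈ L has
-- J ∩ Eᵢ dependent in Uᵢ; a maximal Uᵢ-independent B with I ∩ Eᵢ ⊆ B ⊆ J ∩ Eᵢ
-- is then a base of Uᵢ by uniformity, and I ∪ B closes block i, so we recurse
-- on a shorter list.
module Submission where

open import Defs
open import Level using (0ℓ; suc)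
open import Axiom.ExcludedMiddle using (ExcludedMiddle)
open import Axiom.DoubleNegationElimination using (em⇒dne)
open import Data.Nat using (ℕ; _<_)
import Data.Nat as ℕ
open import Data.Nat.Properties using (<-≤-trans; ≤-pred; n<1+n)
open import Data.Fin using (Fin; _≟_)
open import Data.Product using (Σ; ∃; _×_; _,_; proj₁; proj₂)
open import Data.Sum using (inj₁; inj₂)
open import Data.Unit using (tt)
open import Data.Empty using (⊥-elim)
open import Data.List using (List; length; filter; allFin)
open import Data.List.Relation.Unary.Any as Any using (Any)
open import Data.List.Properties using (filter-notAll)
open import Data.List.Membership.Propositional using (_∈_; _∉_)
open import Data.List.Membership.Propositional.Properties using (∈-filter⁺; ∈-allFin)
open import Function using (_∘_)
open import Relation.Nullary using (¬_; Dec; yes; no; ¬?)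
open import Relation.Binary.PropositionalEquality using (_≡_; _≢_; refl; subst)
open import Relation.Unary using (_⊆_; _∩_; _∪_; _≐_; U)

∪｛｝-⊆ : {E : Set} {I K : Subset E} {x : E} → I ⊆ K → K x → I ∪｛ x ｝ ⊆ K
∪｛｝-⊆ I⊆K Kx (inj₁ Iy)   = I⊆K Iy
∪｛｝-⊆ I⊆K Kx (inj₂ refl) = Kx

Maximal-resp-≐ : {E : Set} {F : Family E} → (∀ I J → F J → I ⊆ J → F I) →
  {A B : Subset E} → A ≐ B → Maximal F A → Maximal F B
Maximal-resp-≐ down {A} {B} (A⊆B , B⊆A) (FA , maxA) =
  down B A FA B⊆A , λ K FK B⊆K → A⊆B ∘ maxA K FK (B⊆K ∘ A⊆B)

module _ (em : ExcludedMiddle 0ℓ) where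

  ⊈⇒∃∖ : {E : Set} {A B : Subset E} → ¬ (A ⊆ B) → ∃ λ x → A x × ¬ B x
  ⊈⇒∃∖ {A = A} {B} A⊈B with em {∃ λ x → A x × ¬ B x}
  ... | yes witness = witness
  ... | no none     = ⊥-elim (A⊈B λ {x} Ax → em⇒dne em λ ¬Bx → none (x , Ax , ¬Bx))

  module _ {E : Set} {G : Subset E} {Ind : Family E}
           (matroid : IsMatroid G Ind) (uniform : IsUniform G Ind) where

    open IsMatroid matroid using (down)

    uniform-∪｛｝ : ∀ {B x f} → Ind (B ∪｛ x ｝) → ¬ B x → G f → ¬ B f →
      Ind (B ∪｛ f ｝)
    uniform-∪｛｝ {B} {x} {f} indBx ¬Bx Gf ¬Bf with em {f ≡ x}
    ... | yes refl = indBx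
    ... | no f≢x   = down (B ∪｛ f ｝) (swap (B ∪｛ x ｝) x f)
                          (uniform (B ∪｛ x ｝) x f indBx (inj₂ refl) Gf f∉Bx) B+f⊆swap
      where
      f∉Bx : ¬ (B ∪｛ x ｝) f
      f∉Bx (inj₁ Bf)  = ¬Bf Bf
      f∉Bx (inj₂ f≡x) = f≢x f≡x
      B+f⊆swap : B ∪｛ f ｝ ⊆ swap (B ∪｛ x ｝) x f
      B+f⊆swap (inj₁ By)  = inj₁ (inj₁ By , λ { refl → ¬Bx By })
      B+f⊆swap (inj₂ y≡f) = inj₂ y≡f

    -- An element f ∈ D ∖ B exists because D is dependent; any x that could
    -- be added to B could be exchanged for f, contradicting maximality in D.
    uniform-base : {D B : Subset E} → D ⊆ G → ¬ Ind D →
      Maximal (λ K → Ind K × K ⊆ D) B → Maximal Ind B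
    uniform-base {D} {B} D⊆G depD ((indB , B⊆D) , maxB) = indB , maxIndB
      where
      maxIndB : ∀ K → Ind K → B ⊆ K → K ⊆ B
      maxIndB K indK B⊆K {x} Kx with em {B x}
      ... | yes Bx = Bx
      ... | no ¬Bx = ⊥-elim (¬Bf (maxB (B ∪｛ f ｝) (indBf , ∪｛｝-⊆ B⊆D Df) inj₁ (inj₂ refl)))
        where
        D∖B = ⊈⇒∃∖ {A = D} {B} (λ D⊆B → depD (down D B indB D⊆B))
        f   = proj₁ D∖B
        Df  = proj₁ (proj₂ D∖B)
        ¬Bf = proj₂ (proj₂ D∖B)
        indBf : Ind (B ∪｛ f ｝)
        indBf = uniform-∪｛｝ (down (B ∪｛ x ｝) K indK (∪｛｝-⊆ B⊆K Kx)) ¬Bx (D⊆G Df) ¬Bf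

  module CommonIndependent
    (E : Set) (n : ℕ) (Es : Fin n → Subset E)
    (disjoint : ∀ i j (x : E) → Es i x → Es j x → i ≡ j)
    (cover : ∀ (x : E) → ∃ λ i → Es i x)
    (Us : Fin n → Family E)
    (Us-matroid : ∀ i → IsMatroid (Es i) (Us i))
    (Us-uniform : ∀ i → IsUniform (Es i) (Us i))
    (IndM : Family E) (M-matroid : IsMatroid U IndM) where

    open import Data.List.Membership.DecPropositional (_≟_ {n}) using (_∈?_)
    open IsMatroid M-matroid using (maximal) renaming (down to downM)

    downU : ∀ i → ∀ I J → Us i J → I ⊆ J → Us i I
    downU i = IsMatroid.down (Us-matroid i)

    IndN : Family E
    IndN = DirectSumInd n Es Us

    Common : Family E
    Common K = IndM K × IndN K

    ExtendsToMaximal : Subset E → Set₁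
    ExtendsToMaximal I = Σ (Subset E) λ J → Maximal Common J × I ⊆ J

    Saturated : List (Fin n) → Subset E → Set₁
    Saturated L I = Common I × (∀ i → i ∉ L → Maximal (Us i) (I ∩ Es i))

    module Extension {L : List (Fin n)} {I : Subset E} (sat : Saturated L I) where

      Span : Subset E
      Span = I ∪ λ x → ∃ λ i → i ∈ L × Es i x

      private
        extension = maximal Span (λ _ → tt) I (proj₁ (proj₁ sat)) inj₁

      J : Subset E
      J = proj₁ extension

      J-max : Maximal (λ K → IndM K × K ⊆ Span) J
      J-max = proj₁ (proj₂ extension)

      I⊆J : I ⊆ J
      I⊆J = proj₂ (proj₂ extension)

      J∩Eᵢ⊆I∩Eᵢ : ∀ i → i ∉ L → J ∩ Es i ⊆ I ∩ Es i
      J∩Eᵢ⊆I∩Eᵢ i i∉L {x} (Jx , Eix) with proj₂ (proj₁ J-max) Jx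
      ... | inj₁ Ix              = Ix , Eix
      ... | inj₂ (j , j∈L , Ejx) = ⊥-elim (i∉L (subst (_∈ L) (disjoint j i x Ejx Eix) j∈L))

      J-maximal : IndN J → Maximal Common J
      J-maximal indNJ = (proj₁ (proj₁ J-max) , indNJ) , maxJ
        where
        maxJ : ∀ K → Common K → J ⊆ K → K ⊆ J
        maxJ K (indMK , indNK) J⊆K {x} Kx with cover x
        ... | i , Eix with i ∈? L
        ... | yes i∈L = proj₂ J-max (J ∪｛ x ｝)
                          ( downM (J ∪｛ x ｝) K indMK (∪｛｝-⊆ J⊆K Kx)
                          , ∪｛｝-⊆ (proj₂ (proj₁ J-max)) (inj₂ (i , i∈L , Eix)))
                          inj₁ (inj₂ refl)
        ... | no i∉L  = I⊆J (proj₁ (proj₂ (proj₂ sat i i∉L) (K ∩ Es i) (indNK i)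
                          (λ (Iy , Eiy) → J⊆K (I⊆J Iy) , Eiy) (Kx , Eix)))

      dependent-∈ : ∀ i → ¬ Us i (J ∩ Es i) → i ∈ L
      dependent-∈ i dep with i ∈? L
      ... | yes i∈L = i∈L
      ... | no i∉L  = ⊥-elim (dep (downU i (J ∩ Es i) (I ∩ Es i)
                        (proj₁ (proj₂ sat i i∉L)) (J∩Eᵢ⊆I∩Eᵢ i i∉L)))

      module Close (i : Fin n) (dep : ¬ Us i (J ∩ Es i)) where

        private
          completion = IsMatroid.maximal (Us-matroid i) (J ∩ Es i) proj₂ (I ∩ Es i)
                         (proj₂ (proj₁ sat) i) (λ (Ix , Eix) → I⊆J Ix , Eix)

        B : Subset E
        B = proj₁ completion

        B⊆J∩Eᵢ : B ⊆ J ∩ Es i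
        B⊆J∩Eᵢ = proj₂ (proj₁ (proj₁ (proj₂ completion)))

        I∩Eᵢ⊆B : I ∩ Es i ⊆ B
        I∩Eᵢ⊆B = proj₂ (proj₂ completion)

        B-base : Maximal (Us i) B
        B-base = uniform-base (Us-matroid i) (Us-uniform i) proj₂ dep (proj₁ (proj₂ completion))

        I′ : Subset E
        I′ = I ∪ B

        L′ : List (Fin n)
        L′ = filter (¬? ∘ (_≟ i)) L

        L′-shorter : length L′ < length L
        L′-shorter = filter-notAll (¬? ∘ (_≟ i)) L
                       (Any.map (λ { refl i≢i → i≢i refl }) (dependent-∈ i dep))

        B≐I′∩Eᵢ : B ≐ I′ ∩ Es i
        B≐I′∩Eᵢ = (λ Bx → inj₂ Bx , proj₂ (B⊆J∩Eᵢ Bx))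
                 , λ { (inj₁ Ix , Eix) → I∩Eᵢ⊆B (Ix , Eix) ; (inj₂ Bx , _) → Bx }

        I∩Eⱼ≐I′∩Eⱼ : ∀ j → j ≢ i → I ∩ Es j ≐ I′ ∩ Es j
        I∩Eⱼ≐I′∩Eⱼ j j≢i = (λ (Ix , Ejx) → inj₁ Ix , Ejx)
                         , λ { (inj₁ Ix , Ejx) → Ix , Ejx
                             ; {x} (inj₂ Bx , Ejx) → ⊥-elim (j≢i (disjoint j i x Ejx (proj₂ (B⊆J∩Eᵢ Bx)))) }

        I′-saturated : Saturated L′ I′
        I′-saturated = (indMI′ , indNI′) , I′-base
          where
          indMI′ : IndM I′
          indMI′ = downM I′ J (proj₁ (proj₁ J-max)) λ { (inj₁ Ix) → I⊆J Ix ; (inj₂ Bx) → proj₁ (B⊆J∩Eᵢ Bx) }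

          indNI′ : IndN I′
          indNI′ j with j ≟ i
          ... | yes refl = downU i (I′ ∩ Es i) B (proj₁ B-base) (proj₂ B≐I′∩Eᵢ)
          ... | no j≢i   = downU j (I′ ∩ Es j) (I ∩ Es j) (proj₂ (proj₁ sat) j) (proj₂ (I∩Eⱼ≐I′∩Eⱼ j j≢i))

          I′-base : ∀ j → j ∉ L′ → Maximal (Us j) (I′ ∩ Es j)
          I′-base j j∉L′ with j ≟ i
          ... | yes refl = Maximal-resp-≐ (downU i) B≐I′∩Eᵢ B-base
          ... | no j≢i   = Maximal-resp-≐ (downU j) (I∩Eⱼ≐I′∩Eⱼ j j≢i)
                             (proj₂ sat j (λ j∈L → j∉L′ (∈-filter⁺ (¬? ∘ (_≟ i)) j∈L j≢i)))

    extend : ∀ k {L I} → length L < k → Saturated L I → ExtendsToMaximal I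
    extend ℕ.zero    ()    _
    extend (ℕ.suc k) {I = I} len<k sat = conclude em
      where
      open Extension sat

      conclude : Dec (∃ λ i → ¬ Us i (J ∩ Es i)) → ExtendsToMaximal I
      conclude (no ¬dep)       = J , J-maximal (λ i → em⇒dne em λ dep → ¬dep (i , dep)) , I⊆J
      conclude (yes (i , dep)) =
        let J′ , J′-max , I′⊆J′ = extend k (<-≤-trans L′-shorter (≤-pred len<k)) I′-saturated
        in J′ , J′-max , I′⊆J′ ∘ inj₁
        where open Close i dep

lemma3p2 : ExcludedMiddle 0ℓ → ExcludedMiddle (suc 0ℓ) →
    (E : Set) (n : ℕ) (Es : Fin n → Subset E) →
    (∀ i j (x : E) → Es i x → Es j x → i ≡ j) →
    (∀ (x : E) → ∃ λ i → Es i x) →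
    (Us : Fin n → Family E) →
    (∀ i → IsMatroid (Es i) (Us i)) →
    (∀ i → IsUniform (Es i) (Us i)) →
    (IndM : Family E) → IsMatroid U IndM →
    ∀ (I : Subset E) → IndM I → DirectSumInd n Es Us I →
    Σ (Subset E) λ J →
      Maximal (λ K → IndM K × DirectSumInd n Es Us K) J × I ⊆ J
-- Excluded middle for Set suffices.
lemma3p2 em _ E n Es disjoint cover Us Us-matroid Us-uniform IndM M-matroid I indM indN =
  extend (ℕ.suc (length (allFin n))) (n<1+n _) ((indM , indN) , λ i i∉ → ⊥-elim (i∉ (∈-allFin i)))
  where open CommonIndependent em E n Es disjoint cover Us Us-matroid Us-uniform IndM M-matroid
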